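{- Let $\ell\ge 2$. In the cyclic Kautz digraph $CK(2,\ell)$ there is a directed path from a vertex $u$ to a vertex $v$ if and only if the imprint of $v$ contains the same number of $+$ signs and the same number of $-$ signs as the imprint of $u$.
   Context: $CK(2,\ell)$ has as vertices all words $a_1\ldots a_\ell$ over $\Sigma=\{0,1,2\}$ with $a_i\ne a_{i+1}$ for $1\le i\le\ell-1$ and $a_1\ne a_\ell$, and an arc from $a_1a_2\ldots a_\ell$ to $a_2\ldots a_\ell a_{\ell+1}$ whenever both words are vertices. Define $sgn(0,1)=sgn(1,2)=sgn(2,0)=+$ and $sgn(1,0)=sgn(2,1)=sgn(0,2)=-$. The imprint of a vertex $v=v_1\ldots v_\ell$ is the sign sequence whose $i$-th entry is $sgn(v_i,v_{i+1})$ for $1\le i\le\ell-1$ and whose last entry is $sgn(v_\ell,v_1)$. -}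

module Defs where

open import Data.Nat using (ℕ; suc; _≥_)
open import Data.Fin using (Fin; zero; suc)
open import Data.Vec using (Vec; []; _∷_; head; last; tail; _∷ʳ_; zipWith; count)
open import Data.Product using (_×_; Σ; _,_)
open import Relation.Binary.PropositionalEquality using (_≡_; _≢_)
open import Relation.Nullary using (Dec; yes; no)
open import Relation.Unary using (Pred)
open import Relation.Binary.Construct.Closure.ReflexiveTransitive using (Star)

Σ₃ : Set
Σ₃ = Fin 3

data NoRepeat : {n : ℕ} → Vec Σ₃ n → Set where
  nr[]  : NoRepeat []
  nr[_] : (a : Σ₃) → NoRepeat (a ∷ [])
  nr∷   : ∀ {n} {a b : Σ₃} {w : Vec Σ₃ n} →
          a ≢ b → NoRepeat (b ∷ w) → NoRepeat (a ∷ b ∷ w)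

IsVertex : (ℓ : ℕ) → Vec Σ₃ (suc ℓ) → Set
IsVertex ℓ w = NoRepeat w × (head w ≢ last w)

-- vertices of CK(2, suc ℓ)
Vertex : ℕ → Set
Vertex ℓ = Σ (Vec Σ₃ (suc ℓ)) (IsVertex ℓ)

Arc : (ℓ : ℕ) → Vertex ℓ → Vertex ℓ → Set
Arc ℓ (u , _) (v , _) = Σ Σ₃ (λ c → v ≡ tail u ∷ʳ c)

Path : (ℓ : ℕ) → Vertex ℓ → Vertex ℓ → Set
Path ℓ = Star (Arc ℓ)

data Sign : Set where
  plus minus zeroS : Sign

-- sgn(0,1)=sgn(1,2)=sgn(2,0)=+, sgn(1,0)=sgn(2,1)=sgn(0,2)=−
-- (equal letters never occur in a vertex; they get a dummy value)
sgn : Σ₃ → Σ₃ → Sign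
sgn zero (suc zero) = plus
sgn (suc zero) (suc (suc zero)) = plus
sgn (suc (suc zero)) zero = plus
sgn (suc zero) zero = minus
sgn (suc (suc zero)) (suc zero) = minus
sgn zero (suc (suc zero)) = minus
sgn _ _ = zeroS

rotate : ∀ {n} → Vec Σ₃ (suc n) → Vec Σ₃ (suc n)
rotate (a ∷ w) = w ∷ʳ a

imprint : ∀ {n} → Vec Σ₃ (suc n) → Vec Sign (suc n)
imprint w = zipWith sgn w (rotate w)

isPlus : (s : Sign) → Dec (s ≡ plus)
isPlus plus = yes _≡_.refl
isPlus minus = no (λ ())
isPlus zeroS = no (λ ())

isMinus : (s : Sign) → Dec (s ≡ minus)
isMinus minus = yes _≡_.refl
isMinus plus = no (λ ())
isMinus zeroS = no (λ ())

#plus : ∀ {n} → Vec Sign n → ℕ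
#plus = count isPlus

#minus : ∀ {n} → Vec Sign n → ℕ
#minus = count isMinus

-- A vertex a₁ … a_ℓ is a closed walk a₁, …, a_ℓ, a₁ on the triangle Σ₃ and its imprint lists
-- the directions of the steps. An arc drops a₁ and appends some c; the two steps through a₁ and
-- the two steps through c connect the same letters a_ℓ and a₂, so they have the same sum mod 3 and
-- hence form the same pair of signs: the imprint is only permuted and the sign counts are invariant.
-- Conversely, replacing the middle letter of a detour x y x by the third letter swaps two adjacent
-- opposite signs, and the two vertices are mutually reachable because their concatenation is a walk
-- in which every window is a vertex. Bubble sorting makes every vertex equivalent to the walk with
-- signs +…+−…− from its own first letter. One arc followed by sorting again moves that first letter
-- one step further, and two such moves visit all three letters; as a walk is determined by its first
-- letter and its signs, any two vertices with the same number of pluses reach each other.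

module Submission where

open import Defs
open import Data.Nat using (ℕ; zero; suc; _+_; _≤_; _<_; _≥_; z≤n; s≤s) renaming (_≟_ to _≟ℕ_)
open import Data.Nat.Properties using (+-commutativeSemigroup; +-comm; +-assoc; +-suc; ≤-refl; ≤-pred; ≤-trans; <⇒≤; m≤n⇒m≤1+n; m≤n⇒m<n∨m≡n; m≤m+n; m≤n+m; ≤-reflexive; +-monoʳ-≤; 1+n≰n; 1+n≢n; <⇒≢; suc-injective; +-identityʳ; +-mono-≤-<)
open import Algebra.Properties.CommutativeSemigroup +-commutativeSemigroup using (x∙yz≈y∙xz)
open import Data.Fin using (_≟_)
open import Data.Fin.Properties using (all?; any?)
open import Data.Vec using (Vec; []; _∷_; [_]; head; last; _∷ʳ_; zipWith; count)
open import Data.Vec.Properties using (last-∷ʳ)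
open import Data.Product using (_×_; _,_; proj₁; proj₂; Σ; ∃)
open import Data.Product.Properties using (≡-dec)
open import Data.Sum using (_⊎_; inj₁; inj₂)
open import Data.Empty using (⊥-elim)
open import Data.Bool using (true; false)
open import Relation.Binary.PropositionalEquality using (_≡_; _≢_; refl; sym; trans; cong; cong₂; subst; subst₂; module ≡-Reasoning)
open import Relation.Binary.Definitions using (DecidableEquality)
open import Relation.Nullary using (Dec; yes; no; does; ¬?)
open import Relation.Nullary.Decidable using (toWitness; _→-dec_; _⊎-dec_; _×-dec_)
open import Relation.Unary using (Decidable)
open import Relation.Binary.Construct.Closure.ReflexiveTransitive using (ε; _◅_; _◅◅_)
open import Function.Base using (_∘_)
open import Function.Bundles using (_⇔_; mk⇔)

_≟ˢ_ : DecidableEquality Sign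
plus  ≟ˢ plus  = yes refl
minus ≟ˢ minus = yes refl
zeroS ≟ˢ zeroS = yes refl
plus  ≟ˢ minus = no λ ()
plus  ≟ˢ zeroS = no λ ()
minus ≟ˢ plus  = no λ ()
minus ≟ˢ zeroS = no λ ()
zeroS ≟ˢ plus  = no λ ()
zeroS ≟ˢ minus = no λ ()

opaque
  sgn-two-steps : ∀ z a b c → a ≢ b → z ≢ a → z ≢ c → c ≢ b →
    (sgn a b , sgn z a) ≡ (sgn z c , sgn c b) ⊎ (sgn a b , sgn z a) ≡ (sgn c b , sgn z c)
  sgn-two-steps = toWitness {a? = all? λ z → all? λ a → all? λ b → all? λ c →
    ¬? (a ≟ b) →-dec ¬? (z ≟ a) →-dec ¬? (z ≟ c) →-dec ¬? (c ≟ b) →-dec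
    (≡-dec _≟ˢ_ _≟ˢ_ (sgn a b , sgn z a) (sgn z c , sgn c b) ⊎-dec
     ≡-dec _≟ˢ_ _≟ˢ_ (sgn a b , sgn z a) (sgn c b , sgn z c))} _

  sgn-plus⊎minus : ∀ a b → a ≢ b → sgn a b ≡ plus ⊎ sgn a b ≡ minus
  sgn-plus⊎minus = toWitness {a? = all? λ a → all? λ b →
    ¬? (a ≟ b) →-dec ((sgn a b ≟ˢ plus) ⊎-dec (sgn a b ≟ˢ minus))} _

  sgn-injectiveʳ : ∀ a b c → a ≢ b → a ≢ c → sgn a b ≡ sgn a c → b ≡ c
  sgn-injectiveʳ = toWitness {a? = all? λ a → all? λ b → all? λ c →
    ¬? (a ≟ b) →-dec ¬? (a ≟ c) →-dec (sgn a b ≟ˢ sgn a c) →-dec (b ≟ c)} _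

  sgn-minus-plus : ∀ a b c → sgn a b ≡ minus → sgn b c ≡ plus → c ≡ a
  sgn-minus-plus = toWitness {a? = all? λ a → all? λ b → all? λ c →
    (sgn a b ≟ˢ minus) →-dec (sgn b c ≟ˢ plus) →-dec (c ≟ a)} _

  sgn-detour : ∀ a b → a ≢ b → ∃ λ c → c ≢ a × sgn a c ≡ sgn b a × sgn c a ≡ sgn a b
  sgn-detour = toWitness {a? = all? λ a → all? λ b → ¬? (a ≟ b) →-dec any? λ c →
    ¬? (c ≟ a) ×-dec (sgn a c ≟ˢ sgn b a) ×-dec (sgn c a ≟ˢ sgn a b)} _

  sgn-repeated-covers : ∀ a b c → a ≢ b → sgn a b ≡ sgn b c → ∀ y → y ≡ a ⊎ y ≡ b ⊎ y ≡ c
  sgn-repeated-covers = toWitness {a? = all? λ a → all? λ b → all? λ c →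
    ¬? (a ≟ b) →-dec (sgn a b ≟ˢ sgn b c) →-dec all? λ y → (y ≟ a) ⊎-dec (y ≟ b) ⊎-dec (y ≟ c)} _

stepSigns : ∀ {n} → Σ₃ → Vec Σ₃ n → Vec Sign n
stepSigns x []       = []
stepSigns x (y ∷ ys) = sgn x y ∷ stepSigns y ys

zipWith-sgn-∷ʳ : ∀ {n} x (xs : Vec Σ₃ n) y → zipWith sgn (x ∷ xs) (xs ∷ʳ y) ≡ stepSigns x (xs ∷ʳ y)
zipWith-sgn-∷ʳ x []        y = refl
zipWith-sgn-∷ʳ x (x′ ∷ xs) y = cong (sgn x x′ ∷_) (zipWith-sgn-∷ʳ x′ xs y)

imprint-∷ : ∀ {n} x (xs : Vec Σ₃ n) → imprint (x ∷ xs) ≡ stepSigns x (xs ∷ʳ x)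
imprint-∷ x xs = zipWith-sgn-∷ʳ x xs x

stepSigns-∷ʳ : ∀ {n} x (xs : Vec Σ₃ n) y → stepSigns x (xs ∷ʳ y) ≡ stepSigns x xs ∷ʳ sgn (last (x ∷ xs)) y
stepSigns-∷ʳ x []        y = refl
stepSigns-∷ʳ x (x′ ∷ xs) y = cong (sgn x x′ ∷_) (stepSigns-∷ʳ x′ xs y)

imprint-∷-∷ : ∀ {n} a b (w : Vec Σ₃ n) → imprint (a ∷ b ∷ w) ≡ sgn a b ∷ (stepSigns b w ∷ʳ sgn (last (b ∷ w)) a)
imprint-∷-∷ a b w = trans (imprint-∷ a (b ∷ w)) (cong (sgn a b ∷_) (stepSigns-∷ʳ b w a))

imprint-∷-∷ʳ : ∀ {n} b (w : Vec Σ₃ n) c → imprint (b ∷ (w ∷ʳ c)) ≡ (stepSigns b w ∷ʳ sgn (last (b ∷ w)) c) ∷ʳ sgn c b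
imprint-∷-∷ʳ b w c = begin
  imprint (b ∷ (w ∷ʳ c))                              ≡⟨ imprint-∷ b (w ∷ʳ c) ⟩
  stepSigns b ((w ∷ʳ c) ∷ʳ b)                         ≡⟨ stepSigns-∷ʳ b (w ∷ʳ c) b ⟩
  stepSigns b (w ∷ʳ c) ∷ʳ sgn (last (b ∷ (w ∷ʳ c))) b ≡⟨ cong₂ (λ xs y → xs ∷ʳ sgn y b) (stepSigns-∷ʳ b w c) (last-∷ʳ c (b ∷ w)) ⟩
  (stepSigns b w ∷ʳ sgn (last (b ∷ w)) c) ∷ʳ sgn c b  ∎
  where open ≡-Reasoning

NoRepeat-head : ∀ {n a b} {w : Vec Σ₃ n} → NoRepeat (a ∷ b ∷ w) → a ≢ b
NoRepeat-head (nr∷ a≢b _) = a≢b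

NoRepeat-∷ʳ : ∀ {n} x (xs : Vec Σ₃ n) y → NoRepeat (x ∷ (xs ∷ʳ y)) → last (x ∷ xs) ≢ y
NoRepeat-∷ʳ x []        y (nr∷ x≢y _) = x≢y
NoRepeat-∷ʳ x (x′ ∷ xs) y (nr∷ _ r)   = NoRepeat-∷ʳ x′ xs y r

module _ {P : Sign → Set} (P? : Decidable P) where

  private
    #_ : ∀ {n} → Vec Sign n → ℕ
    #_ = count P?

  count-∷ : ∀ {n} s (xs : Vec Sign n) → # (s ∷ xs) ≡ # [ s ] + # xs
  count-∷ s xs with does (P? s)
  ... | true  = refl
  ... | false = refl

  count-∷ʳ : ∀ {n} (xs : Vec Sign n) s → # (xs ∷ʳ s) ≡ # xs + # [ s ]
  count-∷ʳ []       s = refl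
  count-∷ʳ (x ∷ xs) s = begin
    # (x ∷ (xs ∷ʳ s))          ≡⟨ count-∷ x (xs ∷ʳ s) ⟩
    # [ x ] + # (xs ∷ʳ s)      ≡⟨ cong (# [ x ] +_) (count-∷ʳ xs s) ⟩
    # [ x ] + (# xs + # [ s ]) ≡⟨ +-assoc (# [ x ]) (# xs) (# [ s ]) ⟨
    (# [ x ] + # xs) + # [ s ] ≡⟨ cong (_+ # [ s ]) (count-∷ x xs) ⟨
    # (x ∷ xs) + # [ s ]       ∎
    where open ≡-Reasoning

  count-∷-∷ʳ : ∀ {n} x (ys : Vec Sign n) y → # (x ∷ (ys ∷ʳ y)) ≡ # ys + (# [ x ] + # [ y ])
  count-∷-∷ʳ x ys y = begin
    # (x ∷ (ys ∷ʳ y))          ≡⟨ count-∷ x (ys ∷ʳ y) ⟩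
    # [ x ] + # (ys ∷ʳ y)      ≡⟨ cong (# [ x ] +_) (count-∷ʳ ys y) ⟩
    # [ x ] + (# ys + # [ y ]) ≡⟨ x∙yz≈y∙xz (# [ x ]) (# ys) (# [ y ]) ⟩
    # ys + (# [ x ] + # [ y ]) ∎
    where open ≡-Reasoning

  count-∷ʳ-∷ʳ : ∀ {n} (ys : Vec Sign n) x y → # ((ys ∷ʳ x) ∷ʳ y) ≡ # ys + (# [ x ] + # [ y ])
  count-∷ʳ-∷ʳ ys x y = begin
    # ((ys ∷ʳ x) ∷ʳ y)         ≡⟨ count-∷ʳ (ys ∷ʳ x) y ⟩
    # (ys ∷ʳ x) + # [ y ]      ≡⟨ cong (_+ # [ y ]) (count-∷ʳ ys x) ⟩
    (# ys + # [ x ]) + # [ y ] ≡⟨ +-assoc (# ys) (# [ x ]) (# [ y ]) ⟩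
    # ys + (# [ x ] + # [ y ]) ∎
    where open ≡-Reasoning

  count-pair : ∀ {x y x′ y′} → (x , y) ≡ (x′ , y′) ⊎ (x , y) ≡ (y′ , x′) → # [ x ] + # [ y ] ≡ # [ x′ ] + # [ y′ ]
  count-pair (inj₁ refl) = refl
  count-pair {x} {y} (inj₂ refl) = +-comm (# [ x ]) (# [ y ])

  -- An arc replaces the two imprint entries around the dropped letter a
  -- by the two around the appended letter c, and these form the same pair.
  arc-preserves-count : ∀ {k} {u v : Vertex k} → Arc k u v →
                        # imprint (proj₁ u) ≡ # imprint (proj₁ v)
  arc-preserves-count {zero} {(a ∷ []) , _ , a≢a} _ = ⊥-elim (a≢a refl)
  arc-preserves-count {suc k} {(a ∷ b ∷ w) , ru , a≢z} {._ , rv , b≢c} (c , refl) = begin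
    # imprint (a ∷ b ∷ w)                          ≡⟨ cong #_ (imprint-∷-∷ a b w) ⟩
    # (sgn a b ∷ (stepSigns b w ∷ʳ sgn z a))       ≡⟨ count-∷-∷ʳ (sgn a b) (stepSigns b w) (sgn z a) ⟩
    # stepSigns b w + (# [ sgn a b ] + # [ sgn z a ]) ≡⟨ cong (# stepSigns b w +_) (count-pair same-pair) ⟩
    # stepSigns b w + (# [ sgn z c ] + # [ sgn c b ]) ≡⟨ count-∷ʳ-∷ʳ (stepSigns b w) (sgn z c) (sgn c b) ⟨
    # ((stepSigns b w ∷ʳ sgn z c) ∷ʳ sgn c b)      ≡⟨ cong #_ (imprint-∷-∷ʳ b w c) ⟨
    # imprint (b ∷ (w ∷ʳ c))                       ∎
    where
      open ≡-Reasoning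
      z = last (b ∷ w)
      same-pair = sgn-two-steps z a b c (NoRepeat-head ru) (a≢z ∘ sym) (NoRepeat-∷ʳ b w c rv)
                                (λ c≡b → b≢c (sym (trans (last-∷ʳ c (b ∷ w)) c≡b)))

  path-preserves-count : ∀ {k} {u v : Vertex k} → Path k u v →
                         # imprint (proj₁ u) ≡ # imprint (proj₁ v)
  path-preserves-count ε = refl
  path-preserves-count {u = u} (_◅_ {j = m} a as) = trans (arc-preserves-count {u = u} {m} a) (path-preserves-count as)

window : ∀ {A : Set} n → (ℕ → A) → Vec A n
window zero    f = []
window (suc n) f = f 0 ∷ window n (f ∘ suc)

window-cong : ∀ {A : Set} n {f g : ℕ → A} → (∀ j → j < n → f j ≡ g j) → window n f ≡ window n g
window-cong zero    f≗g = refl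
window-cong (suc n) f≗g = cong₂ _∷_ (f≗g 0 (s≤s z≤n)) (window-cong n (λ j j<n → f≗g (suc j) (s≤s j<n)))

window-suc : ∀ {A : Set} n (f : ℕ → A) → window (suc n) f ≡ window n f ∷ʳ f n
window-suc zero    f = refl
window-suc (suc n) f = cong (f 0 ∷_) (window-suc n (f ∘ suc))

last-window : ∀ {A : Set} n (f : ℕ → A) → last (window (suc n) f) ≡ f n
last-window n f = trans (cong last (window-suc n f)) (last-∷ʳ (f n) (window n f))

zipWith-window : ∀ {A B C : Set} n (_∙_ : A → B → C) f g →
                 zipWith _∙_ (window n f) (window n g) ≡ window n (λ j → f j ∙ g j)
zipWith-window zero    _∙_ f g = refl
zipWith-window (suc n) _∙_ f g = cong (f 0 ∙ g 0 ∷_) (zipWith-window n _∙_ (f ∘ suc) (g ∘ suc))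

Seq : Set
Seq = ℕ → Σ₃

NoRepeatUpTo : ℕ → Seq → Set
NoRepeatUpTo n g = ∀ j → j < n → g j ≢ g (suc j)

NoRepeat-window⁺ : ∀ n g → NoRepeatUpTo n g → NoRepeat (window (suc n) g)
NoRepeat-window⁺ zero    g _  = nr[ g 0 ]
NoRepeat-window⁺ (suc n) g nr = nr∷ (nr 0 (s≤s z≤n)) (NoRepeat-window⁺ n (g ∘ suc) (λ j j<n → nr (suc j) (s≤s j<n)))

NoRepeat-window⁻ : ∀ n g → NoRepeat (window (suc n) g) → NoRepeatUpTo n g
NoRepeat-window⁻ (suc n) g (nr∷ g₀≢g₁ _) zero    _         = g₀≢g₁
NoRepeat-window⁻ (suc n) g (nr∷ _ r)     (suc j) (s≤s j<n) = NoRepeat-window⁻ n (g ∘ suc) r j j<n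

extend : ∀ {n} → Σ₃ → Vec Σ₃ n → Seq
extend d []       j       = d
extend d (x ∷ xs) zero    = x
extend d (x ∷ xs) (suc j) = extend d xs j

window-extend : ∀ {n} d (xs : Vec Σ₃ n) → window n (extend d xs) ≡ xs
window-extend d []       = refl
window-extend d (x ∷ xs) = cong (x ∷_) (window-extend d xs)

extend-beyond : ∀ {n} d (xs : Vec Σ₃ n) → extend d xs n ≡ d
extend-beyond d []       = refl
extend-beyond d (x ∷ xs) = extend-beyond d xs

NoRepeatUpTo-suc : ∀ {n g} → NoRepeatUpTo n g → g n ≢ g (suc n) → NoRepeatUpTo (suc n) g
NoRepeatUpTo-suc {n} nr gₙ≢gₙ₊₁ j j<1+n with m≤n⇒m<n∨m≡n (≤-pred j<1+n)
... | inj₁ j<n  = nr j j<n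
... | inj₂ refl = gₙ≢gₙ₊₁

NoRepeatUpTo-pred : ∀ {n g} → NoRepeatUpTo (suc n) g → NoRepeatUpTo n g
NoRepeatUpTo-pred nr j j<n = nr j (m≤n⇒m≤1+n j<n)

append : ∀ {A : Set} → ℕ → (ℕ → A) → (ℕ → A) → ℕ → A
append zero    f g       = g
append (suc n) f g zero    = f 0
append (suc n) f g (suc j) = append n (f ∘ suc) g j

append-< : ∀ {A : Set} n (f g : ℕ → A) j → j < n → append n f g j ≡ f j
append-< (suc n) f g zero    _         = refl
append-< (suc n) f g (suc j) (s≤s j<n) = append-< n (f ∘ suc) g j j<n

append-+ : ∀ {A : Set} n (f g : ℕ → A) j → append n f g (n + j) ≡ g j
append-+ zero    f g j = refl
append-+ (suc n) f g j = append-+ n (f ∘ suc) g j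

NoRepeat-append : ∀ n {m f g} → NoRepeatUpTo n f → f n ≢ g 0 → NoRepeatUpTo m g →
                  NoRepeatUpTo (suc n + m) (append (suc n) f g)
NoRepeat-append zero    _   fₙ≢g₀ _   zero    _         = fₙ≢g₀
NoRepeat-append zero    _   _     nrg (suc j) (s≤s j<m) = nrg j j<m
NoRepeat-append (suc n) nrf _     _   zero    _         = nrf 0 (s≤s z≤n)
NoRepeat-append (suc n) nrf fₙ≢g₀ nrg (suc j) (s≤s j<)  =
  NoRepeat-append n (λ j j<n → nrf (suc j) (s≤s j<n)) fₙ≢g₀ nrg j j<

_[_]≔_ : Seq → ℕ → Σ₃ → Seq
(g [ m ]≔ c) j with j ≟ℕ m
... | yes _ = c
... | no  _ = g j

[]≔-updated : ∀ g m c → (g [ m ]≔ c) m ≡ c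
[]≔-updated g m c with m ≟ℕ m
... | yes _   = refl
... | no  m≢m = ⊥-elim (m≢m refl)

[]≔-other : ∀ g {m} c {j} → j ≢ m → (g [ m ]≔ c) j ≡ g j
[]≔-other g {m} c {j} j≢m with j ≟ℕ m
... | yes j≡m = ⊥-elim (j≢m j≡m)
... | no  _   = refl

stepSign : Seq → ℕ → Sign
stepSign g j = sgn (g j) (g (suc j))

sortedSign : ℕ → ℕ → Sign
sortedSign zero    _       = minus
sortedSign (suc p) zero    = plus
sortedSign (suc p) (suc t) = sortedSign p t

count-sortedSign : ∀ n p → p ≤ n → count isPlus (window n (sortedSign p)) ≡ p
count-sortedSign zero    zero    _         = refl
count-sortedSign (suc n) zero    _         = count-sortedSign n zero z≤n
count-sortedSign (suc n) (suc p) (s≤s p≤n) = cong suc (count-sortedSign n p p≤n)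

module Walks (k : ℕ) where

  word : Seq → Vec Σ₃ (suc k)
  word = window (suc k)

  window-vertex : ∀ {g} → NoRepeatUpTo k g → g 0 ≢ g k → IsVertex k (word g)
  window-vertex {g} nr g₀≢gₖ = NoRepeat-window⁺ k g nr , λ g₀≡last → g₀≢gₖ (trans g₀≡last (last-window k g))

  Closed : Seq → Set
  Closed g = NoRepeatUpTo (suc k) g × g (suc k) ≡ g 0

  closed-vertex : ∀ {g} → Closed g → IsVertex k (word g)
  closed-vertex (nr , closes) =
    window-vertex (NoRepeatUpTo-pred nr) (λ g₀≡gₖ → nr k ≤-refl (trans (sym g₀≡gₖ) (sym closes)))

  vertex-closed : ∀ {u} → IsVertex k u → Closed (extend (head u) u)
  vertex-closed {u@(a ∷ w)} (nr , a≢last) = NoRepeatUpTo-suc nrₖ gₖ≢a , closes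
    where
      g = extend a u
      closes : g (suc k) ≡ a
      closes = extend-beyond a w
      nrₖ : NoRepeatUpTo k g
      nrₖ = NoRepeat-window⁻ k g (subst NoRepeat (sym (window-extend a u)) nr)
      gₖ≢a : g k ≢ g (suc k)
      gₖ≢a gₖ≡ = a≢last (trans (sym closes) (trans (sym gₖ≡) (trans (sym (last-window k g)) (cong last (window-extend a u)))))

  imprint-word : ∀ {g} → Closed g → imprint (word g) ≡ window (suc k) (stepSign g)
  imprint-word {g} (_ , closes) = begin
    zipWith sgn (word g) (window k (g ∘ suc) ∷ʳ g 0)
      ≡⟨ cong (λ x → zipWith sgn (word g) (window k (g ∘ suc) ∷ʳ x)) (sym closes) ⟩
    zipWith sgn (word g) (window k (g ∘ suc) ∷ʳ g (suc k))
      ≡⟨ cong (zipWith sgn (word g)) (sym (window-suc k (g ∘ suc))) ⟩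
    zipWith sgn (word g) (word (g ∘ suc))
      ≡⟨ zipWith-window (suc k) sgn g (g ∘ suc) ⟩
    window (suc k) (stepSign g) ∎
    where open ≡-Reasoning

  -- Quantifying over both vertex proofs avoids having to show that IsVertex is proof-irrelevant.
  Reach : Vec Σ₃ (suc k) → Vec Σ₃ (suc k) → Set
  Reach u v = ∀ pu pv → Path k (u , pu) (v , pv)

  reach-trans : ∀ {u v w} → IsVertex k v → Reach u v → Reach v w → Reach u w
  reach-trans pv u↝v v↝w pu pw = u↝v pu pv ◅◅ v↝w pv pw

  reach-shift : ∀ g → Reach (word g) (word (g ∘ suc))
  reach-shift g _ _ = (g (suc k) , window-suc k (g ∘ suc)) ◅ ε

  drop : ℕ → Seq → Seq
  drop i g j = g (i + j)

  reach-along : ∀ n g → (∀ i → i ≤ suc n → IsVertex k (word (drop i g))) →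
                Reach (word g) (word (drop (suc n) g))
  reach-along zero    g _        = reach-shift g
  reach-along (suc n) g vertices =
    reach-trans (vertices 1 (s≤s z≤n)) (reach-shift g) (reach-along n (g ∘ suc) (λ i i≤ → vertices (suc i) (s≤s i≤)))

  -- A path of length suc k from word g to word g′ runs along the concatenation of the two walks.
  reach-concat : ∀ {g g′} → Closed g → Closed g′ → g k ≢ g′ 0 → (∀ i → i < k → g (suc i) ≢ g′ i) →
                 Reach (word g) (word g′)
  reach-concat {g} {g′} (nr , closes) (nr′ , closes′) gₖ≢g′₀ cross =
    subst₂ Reach (window-cong (suc k) (append-< (suc k) g g′)) (window-cong (suc k) (λ j _ → append-+ (suc k) g g′ j))
      (reach-along k h windows)
    where
      h = append (suc k) g g′
      adjacent : NoRepeatUpTo (suc k + k) h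
      adjacent = NoRepeat-append k (NoRepeatUpTo-pred nr) gₖ≢g′₀ (NoRepeatUpTo-pred nr′)
      ends : ∀ i → i ≤ suc k → h i ≢ h (i + k)
      ends zero    _       = subst₂ _≢_ (sym (append-< (suc k) g g′ 0 (s≤s z≤n))) (sym (append-< (suc k) g g′ k ≤-refl))
                               (λ g₀≡gₖ → nr k ≤-refl (trans (sym g₀≡gₖ) (sym closes)))
      ends (suc i) (s≤s i≤k) with m≤n⇒m<n∨m≡n i≤k
      ... | inj₁ i<k  = subst₂ _≢_ (sym (append-< (suc k) g g′ (suc i) (s≤s i<k)))
                          (sym (trans (cong (h ∘ suc) (+-comm i k)) (append-+ (suc k) g g′ i)))
                          (cross i i<k)
      ... | inj₂ refl = subst₂ _≢_ (sym (trans (cong h (sym (+-identityʳ (suc k)))) (append-+ (suc k) g g′ 0)))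
                          (sym (append-+ (suc k) g g′ k))
                          (λ g′₀≡g′ₖ → nr′ k ≤-refl (trans (sym g′₀≡g′ₖ) (sym closes′)))
      windows : ∀ i → i ≤ suc k → IsVertex k (word (drop i h))
      windows i i≤ = window-vertex
        (λ j j<k e → adjacent (i + j) (+-mono-≤-< i≤ j<k) (trans e (cong h (+-suc i j))))
        (λ e → ends i i≤ (trans (cong h (sym (+-identityʳ i))) e))

  reach-cycle : ∀ {g} → Closed g → Reach (word g) (word g)
  reach-cycle c@(nr , closes) =
    reach-concat c c (λ gₖ≡g₀ → nr _ ≤-refl (trans gₖ≡g₀ (sym closes))) (λ i i<k e → nr i (m≤n⇒m≤1+n i<k) (sym e))

  infix 4 _≈_
  record _≈_ (g g′ : Seq) : Set where
    constructor _⇄_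
    field
      to   : Reach (word g) (word g′)
      from : Reach (word g′) (word g)

  ≈-refl : ∀ {g} → Closed g → g ≈ g
  ≈-refl c = reach-cycle c ⇄ reach-cycle c

  ≈-trans : ∀ {g g′ g″} → Closed g′ → g ≈ g′ → g′ ≈ g″ → g ≈ g″
  ≈-trans c′ (to ⇄ from) (to′ ⇄ from′) =
    reach-trans (closed-vertex c′) to to′ ⇄ reach-trans (closed-vertex c′) from′ from

  flip-closed : ∀ {g m c} → Closed g → m < k → g m ≡ g (suc (suc m)) → c ≢ g m → Closed (g [ suc m ]≔ c)
  flip-closed {g} {m} {c} (nr , closes) m<k loop c≢gₘ = nr″ , closes″
    where
      g″ = g [ suc m ]≔ c
      updated = []≔-updated g (suc m) c
      unchanged : ∀ {j} → j ≢ suc m → g″ j ≡ g j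
      unchanged = []≔-other g c
      distinct : ∀ j → Dec (j ≡ suc m) → Dec (suc j ≡ suc m) → j ≤ k → g″ j ≢ g″ (suc j)
      distinct _ (yes refl) _          _   e = c≢gₘ (trans (sym updated) (trans e (trans (unchanged 1+n≢n) (sym loop))))
      distinct _ (no _)     (yes refl) _   e = c≢gₘ (trans (sym updated) (trans (sym e) (unchanged (1+n≢n ∘ sym))))
      distinct j (no j≢)    (no sj≢)   j≤k e = nr j (s≤s j≤k) (trans (sym (unchanged j≢)) (trans e (unchanged sj≢)))
      nr″ : NoRepeatUpTo (suc k) g″
      nr″ j (s≤s j≤k) = distinct j (j ≟ℕ suc m) (suc j ≟ℕ suc m) j≤k
      closes″ : g″ (suc k) ≡ g″ 0
      closes″ = trans (unchanged (λ e → <⇒≢ m<k (suc-injective (sym e))))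
                      (trans closes (sym (unchanged λ ())))

  flip-reach : ∀ {g m c} → Closed g → m < k → g m ≡ g (suc (suc m)) → c ≢ g m → Reach (word g) (word (g [ suc m ]≔ c))
  flip-reach {g} {m} {c} cl@(nr , closes) m<k loop c≢gₘ = reach-concat cl (flip-closed cl m<k loop c≢gₘ) ends cross
    where
      g″ = g [ suc m ]≔ c
      ends : g k ≢ g″ 0
      ends e = nr k ≤-refl (trans e (trans ([]≔-other g {suc m} c λ ()) (sym closes)))
      cross′ : ∀ i → Dec (i ≡ suc m) → i < k → g (suc i) ≢ g″ i
      cross′ _ (yes refl) _   e = c≢gₘ (trans (sym ([]≔-updated g (suc m) c)) (trans (sym e) (sym loop)))
      cross′ i (no i≢)    i<k e = nr i (m≤n⇒m≤1+n i<k) (sym (trans e ([]≔-other g c i≢)))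
      cross : ∀ i → i < k → g (suc i) ≢ g″ i
      cross i = cross′ i (i ≟ℕ suc m)

  flip : ∀ {g m c} → Closed g → m < k → g m ≡ g (suc (suc m)) → c ≢ g m →
         Closed (g [ suc m ]≔ c) × g ≈ (g [ suc m ]≔ c)
  flip {g} {m} {c} cl@(nr , _) m<k loop c≢gₘ = cl″ , flip-reach cl m<k loop c≢gₘ ⇄ back
    where
      g″ = g [ suc m ]≔ c
      cl″ = flip-closed cl m<k loop c≢gₘ
      unchanged : ∀ {j} → j ≢ suc m → g″ j ≡ g j
      unchanged = []≔-other g c
      restored′ : ∀ j → Dec (j ≡ suc m) → (g″ [ suc m ]≔ g (suc m)) j ≡ g j
      restored′ _ (yes refl) = []≔-updated g″ (suc m) (g (suc m))
      restored′ j (no j≢)    = trans ([]≔-other g″ (g (suc m)) j≢) (unchanged j≢)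
      restored : ∀ j → j < suc k → (g″ [ suc m ]≔ g (suc m)) j ≡ g j
      restored j _ = restored′ j (j ≟ℕ suc m)
      back : Reach (word g″) (word g)
      back = subst (Reach (word g″)) (window-cong (suc k) restored)
        (flip-reach cl″ m<k (trans (unchanged (1+n≢n ∘ sym)) (trans loop (sym (unchanged (1+n≢n))))) 
                    (λ e → nr m (m≤n⇒m≤1+n m<k) (trans (sym (unchanged (1+n≢n ∘ sym))) (sym e))))

  Agree : ℕ → Seq → Seq → Set
  Agree i g g′ = ∀ j → j ≤ i → g′ j ≡ g j

  agree-pred : ∀ {i g g′} → Agree (suc i) g g′ → Agree i g g′
  agree-pred ag j j≤i = ag j (m≤n⇒m≤1+n j≤i)

  agree-stepSign : ∀ {i g g′} → Agree (suc i) g g′ → stepSign g′ i ≡ stepSign g i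
  agree-stepSign {i} ag = cong₂ sgn (ag i (m≤n⇒m≤1+n ≤-refl)) (ag (suc i) ≤-refl)

  Sorted : ℕ → Seq → ℕ → Set
  Sorted p g i = ∀ t → t + i ≤ k → stepSign g (t + i) ≡ sortedSign p t

  sorted-∷ : ∀ {p q g i} → stepSign g i ≡ sortedSign q 0 → (∀ t → sortedSign q (suc t) ≡ sortedSign p t) →
             Sorted p g (suc i) → Sorted q g i
  sorted-∷         first rest sorted zero    _   = first
  sorted-∷ {g = g} {i} first rest sorted (suc t) t≤k =
    trans (cong (stepSign g) (sym (+-suc t i))) (trans (sorted t (subst (_≤ k) (sym (+-suc t i)) t≤k)) (sym (rest t)))

  record SortedFrom (i p : ℕ) (g : Seq) : Set where
    field
      walk   : Seq
      closed : Closed walk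
      equiv  : g ≈ walk
      agrees : Agree i g walk
      sorted : Sorted p walk i

  sorted-from-plus : ∀ {i p g} → SortedFrom (suc i) p g → stepSign g i ≡ plus → SortedFrom i (suc p) g
  sorted-from-plus {i} {p} S plusᵢ = record
    { walk = walk ; closed = closed ; equiv = equiv ; agrees = agree-pred agrees
    ; sorted = sorted-∷ {p} {suc p} {walk} {i} (trans (agree-stepSign agrees) plusᵢ) (λ _ → refl) sorted }
    where open SortedFrom S

  sorted-from-≈ : ∀ {i p g g′} → Closed g′ → g ≈ g′ → Agree i g g′ → SortedFrom i p g′ → SortedFrom i p g
  sorted-from-≈ c′ g≈g′ ag S = record
    { walk = walk ; closed = closed ; equiv = ≈-trans c′ g≈g′ equiv ; sorted = sorted
    ; agrees = λ j j≤i → trans (agrees j j≤i) (ag j j≤i) }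
    where open SortedFrom S

  record Swapped (i : ℕ) (g : Seq) : Set where
    field
      walk     : Seq
      closed   : Closed walk
      equiv    : g ≈ walk
      agrees   : Agree i g walk
      plusᵢ    : stepSign walk i ≡ plus
      minusᵢ₊₁ : stepSign walk (suc i) ≡ minus
      beyond   : ∀ j → suc (suc i) ≤ j → walk j ≡ g j

  swap-minus-plus : ∀ i {g} → Closed g → i < k → stepSign g i ≡ minus → stepSign g (suc i) ≡ plus → Swapped i g
  swap-minus-plus i {g} cl@(nr , _) i<k minusᵢ plusᵢ₊₁ = record
    { walk = g″ ; closed = proj₁ flipped ; equiv = proj₂ flipped
    ; agrees = λ j j≤i → unchanged λ { refl → 1+n≰n j≤i }
    ; plusᵢ = plus″ᵢ ; minusᵢ₊₁ = minus″ᵢ₊₁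
    ; beyond = λ j 2+i≤j → unchanged λ { refl → 1+n≰n 2+i≤j } }
    where
      loop : g i ≡ g (suc (suc i))
      loop = sym (sgn-minus-plus (g i) (g (suc i)) (g (suc (suc i))) minusᵢ plusᵢ₊₁)
      detour = sgn-detour (g i) (g (suc i)) (nr i (m≤n⇒m≤1+n i<k))
      c = proj₁ detour
      g″ = g [ suc i ]≔ c
      flipped = flip cl i<k loop (proj₁ (proj₂ detour))
      unchanged : ∀ {j} → j ≢ suc i → g″ j ≡ g j
      unchanged = []≔-other g c
      updated : g″ (suc i) ≡ c
      updated = []≔-updated g (suc i) c
      plus″ᵢ : stepSign g″ i ≡ plus
      plus″ᵢ = begin
        sgn (g″ i) (g″ (suc i)) ≡⟨ cong₂ sgn (unchanged (1+n≢n ∘ sym)) updated ⟩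
        sgn (g i) c             ≡⟨ proj₁ (proj₂ (proj₂ detour)) ⟩
        sgn (g (suc i)) (g i)   ≡⟨ cong (sgn (g (suc i))) loop ⟩
        stepSign g (suc i)      ≡⟨ plusᵢ₊₁ ⟩
        plus                    ∎
        where open ≡-Reasoning
      minus″ᵢ₊₁ : stepSign g″ (suc i) ≡ minus
      minus″ᵢ₊₁ = begin
        sgn (g″ (suc i)) (g″ (suc (suc i))) ≡⟨ cong₂ sgn updated (unchanged 1+n≢n) ⟩
        sgn c (g (suc (suc i)))             ≡⟨ cong (sgn c) (sym loop) ⟩
        sgn c (g i)                         ≡⟨ proj₂ (proj₂ (proj₂ detour)) ⟩
        stepSign g i                        ≡⟨ minusᵢ ⟩
        minus                               ∎
        where open ≡-Reasoning

  -- Bubble a minus at position i past the p pluses that follow it.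
  insert-minus : ∀ p i {g} → Closed g → i + p ≤ k → stepSign g i ≡ minus → Sorted p g (suc i) → SortedFrom i p g
  insert-minus zero i {g} cl _ minusᵢ sorted = record
    { walk = g ; closed = cl ; equiv = ≈-refl cl ; agrees = λ _ _ → refl
    ; sorted = sorted-∷ {0} {0} {g} {i} minusᵢ (λ _ → refl) sorted }
  insert-minus (suc p) i {g} cl bound minusᵢ sorted =
    sorted-from-≈ S.closed S.equiv S.agrees
      (sorted-from-plus (insert-minus p (suc i) S.closed bound′ S.minusᵢ₊₁ sorted′) S.plusᵢ)
    where
      bound′ : suc i + p ≤ k
      bound′ = subst (_≤ k) (+-suc i p) bound
      i<k : i < k
      i<k = ≤-trans (s≤s (m≤m+n i p)) bound′
      module S = Swapped (swap-minus-plus i cl i<k minusᵢ (sorted 0 i<k))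
      sorted′ : Sorted p S.walk (suc (suc i))
      sorted′ t t≤k = begin
        stepSign S.walk (t + suc (suc i)) ≡⟨ cong₂ sgn (S.beyond _ (m≤n+m _ t)) (S.beyond _ (m≤n+m _ (suc t))) ⟩
        stepSign g (t + suc (suc i))      ≡⟨ cong (stepSign g) (+-suc t (suc i)) ⟩
        stepSign g (suc t + suc i)        ≡⟨ sorted (suc t) (subst (_≤ k) (+-suc t (suc i)) t≤k) ⟩
        sortedSign p t                    ∎
        where open ≡-Reasoning

  sort-from : ∀ d i {g} → i + d ≡ suc k → Closed g → Σ ℕ λ p → p ≤ d × SortedFrom i p g
  sort-from zero i {g} i≡1+k cl = 0 , z≤n , record
    { walk = g ; closed = cl ; equiv = ≈-refl cl ; agrees = λ _ _ → refl
    ; sorted = λ t t+i≤k → ⊥-elim (1+n≰n (≤-trans (≤-reflexive (trans (sym i≡1+k) (+-identityʳ i)))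
                                                   (≤-trans (m≤n+m i t) t+i≤k))) }
  sort-from (suc d) i {g} i≡1+k cl@(nr , _) with sort-from d (suc i) (trans (sym (+-suc i d)) i≡1+k) cl
  ... | p , p≤d , R = extend-by (sgn-plus⊎minus (g i) (g (suc i)) (nr i i<1+k))
    where
      module R = SortedFrom R
      i<1+k : i < suc k
      i<1+k = subst (i <_) i≡1+k (≤-trans (s≤s (m≤m+n i d)) (≤-reflexive (sym (+-suc i d))))
      bound : i + p ≤ k
      bound = ≤-pred (subst (_≤ suc k) (+-suc i p) (subst (i + suc p ≤_) i≡1+k (+-monoʳ-≤ i (s≤s p≤d))))
      extend-by : stepSign g i ≡ plus ⊎ stepSign g i ≡ minus → Σ ℕ λ p′ → p′ ≤ suc d × SortedFrom i p′ g
      extend-by (inj₁ plusᵢ)  = suc p , s≤s p≤d , sorted-from-plus R plusᵢ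
      extend-by (inj₂ minusᵢ) = p , m≤n⇒m≤1+n p≤d , sorted-from-≈ R.closed R.equiv (agree-pred R.agrees)
        (insert-minus p i R.closed bound (trans (agree-stepSign R.agrees) minusᵢ) R.sorted)

  record Canonical (p : ℕ) (a : Σ₃) (g : Seq) : Set where
    field
      pluses≤ : p ≤ suc k
      closed  : Closed g
      starts  : g 0 ≡ a
      signs   : ∀ t → t ≤ k → stepSign g t ≡ sortedSign p t

  canonical-count : ∀ {p a g} → Canonical p a g → #plus (imprint (word g)) ≡ p
  canonical-count {p} {g = g} C = begin
    count isPlus (imprint (word g))              ≡⟨ cong (count isPlus) (imprint-word closed) ⟩
    count isPlus (window (suc k) (stepSign g))   ≡⟨ cong (count isPlus) (window-cong (suc k) λ t t≤k → signs t (≤-pred t≤k)) ⟩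
    count isPlus (window (suc k) (sortedSign p)) ≡⟨ count-sortedSign (suc k) p pluses≤ ⟩
    p                                            ∎
    where
      open Canonical C
      open ≡-Reasoning

  canonical-unique : ∀ {p a g g′} → Canonical p a g → Canonical p a g′ → word g ≡ word g′
  canonical-unique {g = g} {g′} C C′ = window-cong (suc k) λ t t≤k → agree t (≤-pred t≤k)
    where
      module C  = Canonical C
      module C′ = Canonical C′
      agree : ∀ t → t ≤ k → g t ≡ g′ t
      agree zero    _   = trans C.starts (sym C′.starts)
      agree (suc t) t<k =
        sgn-injectiveʳ (g t) (g (suc t)) (g′ (suc t)) (proj₁ C.closed t t<1+k)
          (subst (_≢ g′ (suc t)) (sym gₜ≡g′ₜ) (proj₁ C′.closed t t<1+k))
          (trans (C.signs t t≤k) (trans (sym (C′.signs t t≤k)) (cong (λ x → sgn x (g′ (suc t))) (sym gₜ≡g′ₜ))))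
        where
          t≤k = <⇒≤ t<k
          t<1+k = m≤n⇒m≤1+n t<k
          gₜ≡g′ₜ = agree t t≤k

  record CanonicalForm (u : Vec Σ₃ (suc k)) : Set where
    field
      pluses    : ℕ
      walk      : Seq
      canonical : Canonical pluses (head u) walk
      to        : Reach u (word walk)
      from      : Reach (word walk) u

  canonicalForm : ∀ {u} → IsVertex k u → CanonicalForm u
  canonicalForm {u@(a ∷ _)} pu = record
    { pluses    = p
    ; walk      = S.walk
    ; canonical = record { pluses≤ = p≤ ; closed = S.closed ; starts = S.agrees 0 z≤n
                         ; signs = λ t t≤k → trans (cong (stepSign S.walk) (sym (+-identityʳ t)))
                                                   (S.sorted t (subst (_≤ k) (sym (+-identityʳ t)) t≤k)) }
    ; to        = subst (λ w → Reach w (word S.walk)) word-g (_≈_.to S.equiv)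
    ; from      = subst (Reach (word S.walk)) word-g (_≈_.from S.equiv)
    }
    where
      g = extend a u
      word-g : word g ≡ u
      word-g = window-extend a u
      sorting = sort-from (suc k) 0 refl (vertex-closed pu)
      p = proj₁ sorting
      p≤ = proj₁ (proj₂ sorting)
      module S = SortedFrom (proj₂ (proj₂ sorting))

  canonicalForm-pluses : ∀ {u} (pu : IsVertex k u) → #plus (imprint u) ≡ CanonicalForm.pluses (canonicalForm pu)
  canonicalForm-pluses pu = trans (path-preserves-count isPlus (to pu (closed-vertex (closed canonical))))
                                  (canonical-count canonical)
    where open CanonicalForm (canonicalForm pu)
          open Canonical

  -- One arc rotates the canonical walk; sorting the rotation gives the canonical walk from the next letter.
  opaque
    next-letter : ∀ {p a g} → Canonical p a g → Σ Seq λ g′ → Canonical p (g 1) g′ × Reach (word g) (word g′)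
    next-letter {p} {g = g} C =
      F.walk , subst (λ q → Canonical q (g 1) F.walk) same-pluses F.canonical , reach-trans pu′ (reach-shift g) F.to
      where
        open Canonical C
        nr : NoRepeatUpTo (suc k) g
        nr = proj₁ closed
        pu′ : IsVertex k (word (g ∘ suc))
        pu′ = window-vertex (λ j j<k → nr (suc j) (s≤s j<k)) (λ g₁≡ → nr 0 (s≤s z≤n) (sym (trans g₁≡ (proj₂ closed))))
        module F = CanonicalForm (canonicalForm pu′)
        same-pluses : F.pluses ≡ p
        same-pluses = begin
          F.pluses                           ≡⟨ sym (canonicalForm-pluses pu′) ⟩
          #plus (imprint (word (g ∘ suc)))   ≡⟨ sym (path-preserves-count isPlus (reach-shift g (closed-vertex closed) pu′)) ⟩
          #plus (imprint (word g))           ≡⟨ canonical-count C ⟩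
          p                                  ∎
          where open ≡-Reasoning

  canonical-first-step : ∀ {p a b g g′} → Canonical p a g → Canonical p b g′ → sgn a (g 1) ≡ sgn b (g′ 1)
  canonical-first-step {p} {a} {b} {g} {g′} C C′ = begin
    sgn a (g 1)   ≡⟨ cong (λ x → sgn x (g 1)) (sym C.starts) ⟩
    stepSign g 0  ≡⟨ C.signs 0 z≤n ⟩
    sortedSign p 0 ≡⟨ C′.signs 0 z≤n ⟨
    stepSign g′ 0 ≡⟨ cong (λ x → sgn x (g′ 1)) C′.starts ⟩
    sgn b (g′ 1)  ∎
    where
      module C  = Canonical C
      module C′ = Canonical C′
      open ≡-Reasoning

  -- Two rotations visit three letters with equal first steps, hence all of Σ₃.
  every-letter : ∀ {p a g} → Canonical p a g → ∀ y → Σ Seq λ g′ → Canonical p y g′ × Reach (word g) (word g′)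
  every-letter {p} {a} {g} C y with next-letter C
  ... | g₁ , C₁ , r₁ with next-letter C₁
  ... | g₂ , C₂ , r₂ with sgn-repeated-covers a (g 1) (g₁ 1) a≢g₁ (canonical-first-step C C₁) y
    where a≢g₁ = subst (_≢ g 1) (Canonical.starts C) (proj₁ (Canonical.closed C) 0 (s≤s z≤n))
  ... | inj₁ y≡a          = g  , subst (λ b → Canonical p b g) (sym y≡a) C , reach-cycle (Canonical.closed C)
  ... | inj₂ (inj₁ y≡g₁₀) = g₁ , subst (λ b → Canonical p b g₁) (sym y≡g₁₀) C₁ , r₁
  ... | inj₂ (inj₂ y≡g₂₀) = g₂ , subst (λ b → Canonical p b g₂) (sym y≡g₂₀) C₂
                                , reach-trans (closed-vertex (Canonical.closed C₁)) r₁ r₂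

  reach-of-equal-pluses : (u v : Vertex k) → #plus (imprint (proj₁ v)) ≡ #plus (imprint (proj₁ u)) → Path k u v
  reach-of-equal-pluses (u , pu) (v , pv) pluses-eq = u↝v pu pv
    where
      module U = CanonicalForm (canonicalForm pu)
      module V = CanonicalForm (canonicalForm pv)
      same-pluses : V.pluses ≡ U.pluses
      same-pluses = trans (sym (canonicalForm-pluses pv)) (trans pluses-eq (canonicalForm-pluses pu))
      target = every-letter U.canonical (head v)
      g′ = proj₁ target
      C′ = proj₁ (proj₂ target)
      lands : word g′ ≡ word V.walk
      lands = canonical-unique C′ (subst (λ q → Canonical q (head v) V.walk) same-pluses V.canonical)
      u↝v : Reach u v
      u↝v = reach-trans (closed-vertex (Canonical.closed U.canonical)) U.to
              (reach-trans (closed-vertex (Canonical.closed C′)) (proj₂ (proj₂ target))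
                (subst (λ w → Reach w v) (sym lands) V.from))

lemma7 : (k : ℕ) → suc k ≥ 2 → (u v : Vertex k) →
    Path k u v ⇔ ((#plus (imprint (proj₁ v)) ≡ #plus (imprint (proj₁ u)))
    × (#minus (imprint (proj₁ v)) ≡ #minus (imprint (proj₁ u))))
lemma7 k _ u v = mk⇔
  (λ u↝v → sym (path-preserves-count isPlus u↝v) , sym (path-preserves-count isMinus u↝v))
  (λ (same-pluses , _) → Walks.reach-of-equal-pluses k u v same-pluses)
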